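{- Let $w,w'\in S_n$, $\alpha=\mathsf{code}(w)$ and $\alpha'=\mathsf{code}(w')$. If there exists $i$ such that $\alpha'_i=\alpha_i-1$ and $\alpha'_k=\alpha_k$ for every $k\neq i$, then $w$ covers $w'$ in the (strong) Bruhat order.
   Context: $S_n$ is the symmetric group generated by simple transpositions $s_i=(i,i+1)$, with length $\ell(w)$ the minimal number of simple transpositions in an expression of $w$. Bruhat order: $u\leqslant w$ if, for a reduced decomposition $w=s_{j_1}\cdots s_{j_r}$, $u$ is a product of a subword $s_{j_{i_1}}\cdots s_{j_{i_k}}$, $i_1<\dots<i_k$; $w$ covers $w'$ if $w'\leqslant w$ and $\ell(w)=\ell(w')+1$. The code of $w\in S_n$ is $\mathsf{code}(w)=(\alpha_1,\dots,\alpha_{n-1})$ with $\alpha_i=\#\{k>i:w(k)<w(i)\}$. -}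

module Defs where

open import Data.Nat using (ℕ; suc; _≤_)
open import Data.Fin using (Fin; inject₁; _<_)
open import Data.Fin.Properties using (_<?_)
open import Data.Fin.Permutation using (Permutation′; _⟨$⟩ʳ_; _∘ₚ_; transpose; _≈_)
  renaming (id to idₚ)
open import Data.List using (List; []; _∷_; length; filter; allFin)
open import Data.List.Relation.Binary.Sublist.Propositional using (_⊆_)
open import Data.Product using (Σ; _×_; ∃; ∃-syntax)
open import Relation.Nullary.Decidable using (_×-dec_)
open import Relation.Binary.PropositionalEquality using (_≡_)

Perm : ℕ → Set
Perm n = Permutation′ n

-- Simple transposition s_{i+1} = (i+1, i+2) (0-indexed: swaps positions i and i+1),
-- indexed by i : Fin m, acting on Fin (suc m).
s : ∀ {m} → Fin m → Perm (suc m)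
s i = transpose (inject₁ i) (Data.Fin.suc i)

-- A word j₁ … j_r denotes the product s_{j₁} ⋯ s_{j_r}
-- (as composition of functions: x ↦ s_{j₁}(⋯ s_{j_r}(x))).
prod : ∀ {m} → List (Fin m) → Perm (suc m)
prod []      = idₚ
prod (j ∷ js) = prod js ∘ₚ s j

Reduced : ∀ {m} → List (Fin m) → Perm (suc m) → Set
Reduced {m} ws w =
  prod ws ≈ w × (∀ (vs : List (Fin m)) → prod vs ≈ w → length ws ≤ length vs)

HasLength : ∀ {m} → Perm (suc m) → ℕ → Set
HasLength w l = ∃[ ws ] (Reduced ws w × length ws ≡ l)

BruhatLe : ∀ {m} → Perm (suc m) → Perm (suc m) → Set
BruhatLe u w = ∃[ ws ] (Reduced ws w × ∃[ vs ] (vs ⊆ ws × prod vs ≈ u))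

Covers : ∀ {m} → Perm (suc m) → Perm (suc m) → Set
Covers w w' = BruhatLe w' w × ∃[ l ] (HasLength w' l × HasLength w (suc l))

-- code(w)_{i+1} = #{k > i+1 : w(k) < w(i+1)}, for i : Fin m  (positions 1..n-1, n = suc m)
code : ∀ {m} → Perm (suc m) → Fin m → ℕ
code {m} w i =
  length (filter (λ k → (inject₁ i <? k) ×-dec ((w ⟨$⟩ʳ k) <? (w ⟨$⟩ʳ inject₁ i)))
                 (allFin (suc m)))

module Submission where

-- ℓ(w) equals the code sum Σᵢ code(w)ᵢ.  It is a lower bound: composing a permutation on the
-- left with s_j exchanges the values j and j+1, which can only increase the code entry at the
-- position holding j, and only by one.  It is attained: w is the cycle 0 ↦ w(0) composed with
-- the lift of w̃ = remove 0 w; that cycle is a product of w(0) = code(w)₀ simple transpositions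
-- and code(w̃) is the tail of code(w), so recursion yields a word of length Σᵢ code(w)ᵢ which
-- depends on code(w) alone.  Lowering one entry of the code deletes one letter of that word, so
-- w′ is a subword of a reduced word of w, and ℓ(w) = ℓ(w′) + 1.

open import Defs
open import Data.Bool using (Bool; true; false; T; _∧_; if_then_else_)
open import Data.Bool.Properties using (T-∧)
open import Data.Empty using (⊥-elim)
open import Data.Fin using (Fin; zero; suc; toℕ; inject₁; punchIn; _≟_)
open import Data.Fin.Permutation
  using (_⟨$⟩ʳ_; _⟨$⟩ˡ_; _∘ₚ_; _≈_; inverseˡ; remove; lift₀;
         lift₀-id; lift₀-comp; lift₀-cong; lift₀-transpose; punchIn-permute)
  renaming (id to idₚ)
open import Data.Fin.Properties
  using (suc-injective; toℕ-injective; toℕ-inject₁; inject₁-injective; toℕ<n; _<?_)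
open import Data.List using (List; []; _∷_; length; filter; tabulate; map; _++_)
open import Data.List.Properties using (length-++; length-map)
open import Data.List.Relation.Binary.Sublist.Propositional
  using (_⊆_; _∷ʳ_; ⊆-refl; ⊆-reflexive)
import Data.List.Relation.Binary.Sublist.Propositional.Properties as Sublist
open import Data.Nat using (ℕ; zero; suc; _+_; _≤_; _<_; _<ᵇ_; z≤n; s≤s)
open import Data.Nat.Properties
  using (≤-refl; ≤-trans; ≤-reflexive; ≤-pred; +-mono-≤; +-suc; m≤n⇒m≤1+n; <⇒≤; _≤?_;
         ≰⇒>; <⇒≱; <-irrefl; <ᵇ⇒<; <⇒<ᵇ; +-0-commutativeMonoid; module ≤-Reasoning)
open import Algebra.Properties.CommutativeMonoid.Sum +-0-commutativeMonoid
  using (sum; sum-cong-≗; sum-permute; sum-replicate-zero)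
open import Data.Product using (_,_; ∃-syntax; _×_)
open import Function using (_∘_; id)
open import Function.Bundles using (Equivalence; Injection)
open import Function.Properties.Inverse using (↔⇒↣)
open import Relation.Nullary using (¬_; yes; no; does)
open import Relation.Nullary.Decidable using (_×-dec_; decidable-stable)
open import Relation.Unary using (Decidable)
open import Relation.Binary.PropositionalEquality

sum-mono-≤ : ∀ {n} {f g : Fin n → ℕ} → (∀ k → f k ≤ g k) → sum f ≤ sum g
sum-mono-≤ {zero}  f≤g = z≤n
sum-mono-≤ {suc n} f≤g = +-mono-≤ (f≤g zero) (sum-mono-≤ (f≤g ∘ suc))

sum-mono-≤-but-one : ∀ {n} {f g : Fin n → ℕ} → (∀ k → f k ≤ suc (g k)) →
  (∀ k k′ → g k < f k → g k′ < f k′ → k ≡ k′) → sum f ≤ suc (sum g)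
sum-mono-≤-but-one {zero} f≤1+g unique = z≤n
sum-mono-≤-but-one {suc n} {f} {g} f≤1+g unique with f zero ≤? g zero
... | yes f₀≤g₀ = subst (sum f ≤_) (+-suc (g zero) (sum (g ∘ suc)))
  (+-mono-≤ f₀≤g₀ (sum-mono-≤-but-one (f≤1+g ∘ suc)
    (λ k k′ gk<fk gk′<fk′ → suc-injective (unique (suc k) (suc k′) gk<fk gk′<fk′))))
... | no f₀≰g₀ = +-mono-≤ (f≤1+g zero) (sum-mono-≤ tail≤)
  where
  tail≤ : ∀ k → f (suc k) ≤ g (suc k)
  tail≤ k with f (suc k) ≤? g (suc k)
  ... | yes fk≤gk = fk≤gk
  ... | no fk≰gk with unique zero (suc k) (≰⇒> f₀≰g₀) (≰⇒> fk≰gk)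
  ...   | ()

sum-mono-≤-except : ∀ {n} {f g : Fin n → ℕ} k₀ → (∀ k → k ≢ k₀ → f k ≤ g k) →
  f k₀ ≤ suc (g k₀) → sum f ≤ suc (sum g)
sum-mono-≤-except {f = f} {g} k₀ f≤g fk₀≤1+gk₀ = sum-mono-≤-but-one f≤1+g
  (λ k k′ gk<fk gk′<fk′ → trans (increase⇒k₀ k gk<fk) (sym (increase⇒k₀ k′ gk′<fk′)))
  where
  increase⇒k₀ : ∀ k → g k < f k → k ≡ k₀
  increase⇒k₀ k gk<fk with k ≟ k₀
  ... | yes k≡k₀ = k≡k₀
  ... | no k≢k₀ = ⊥-elim (<⇒≱ gk<fk (f≤g k k≢k₀))
  f≤1+g : ∀ k → f k ≤ suc (g k)
  f≤1+g k with k ≟ k₀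
  ... | yes refl = fk₀≤1+gk₀
  ... | no k≢k₀ = m≤n⇒m≤1+n (f≤g k k≢k₀)

sum-suc-at : ∀ {n} {f g : Fin n → ℕ} i →
  suc (f i) ≡ g i → (∀ k → k ≢ i → f k ≡ g k) → sum g ≡ suc (sum f)
sum-suc-at {suc n} {f} {g} zero fi+1≡gi f≡g =
  cong₂ _+_ (sym fi+1≡gi) (sym (sum-cong-≗ (λ k → f≡g (suc k) λ ())))
sum-suc-at {suc n} {f} {g} (suc i) fi+1≡gi f≡g = begin
  g zero + sum (g ∘ suc)        ≡⟨ cong₂ _+_ (sym (f≡g zero λ ())) (sum-suc-at i fi+1≡gi f≡g-tail) ⟩
  f zero + suc (sum (f ∘ suc))  ≡⟨ +-suc (f zero) _ ⟩
  suc (sum f)                   ∎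
  where
  open ≡-Reasoning
  f≡g-tail : ∀ k → k ≢ i → f (suc k) ≡ g (suc k)
  f≡g-tail k k≢i = f≡g (suc k) (k≢i ∘ suc-injective)

𝟙 : Bool → ℕ
𝟙 b = if b then 1 else 0

𝟙-mono : ∀ {a b} → (T a → T b) → 𝟙 a ≤ 𝟙 b
𝟙-mono {false}         a⇒b = z≤n
𝟙-mono {true}  {true}  a⇒b = ≤-refl
𝟙-mono {true}  {false} a⇒b = ⊥-elim (a⇒b _)

𝟙≤1 : ∀ b → 𝟙 b ≤ 1
𝟙≤1 false = z≤n
𝟙≤1 true  = ≤-refl

count : ∀ {n} → (Fin n → Bool) → ℕ
count p = sum (𝟙 ∘ p)

count-cong : ∀ {n} {p q : Fin n → Bool} → (∀ k → p k ≡ q k) → count p ≡ count q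
count-cong p≡q = sum-cong-≗ (cong 𝟙 ∘ p≡q)

count-none : ∀ {n} {p : Fin n → Bool} → (∀ k → ¬ T (p k)) → count p ≡ 0
count-none {n} {p} ¬p = trans (sum-cong-≗ 𝟙∘p≡0) (sum-replicate-zero n)
  where
  𝟙∘p≡0 : ∀ k → 𝟙 (p k) ≡ 0
  𝟙∘p≡0 k with p k | ¬p k
  ... | false | _  = refl
  ... | true  | ¬t = ⊥-elim (¬t _)

count-mono : ∀ {n} {p q : Fin n → Bool} → (∀ k → T (p k) → T (q k)) → count p ≤ count q
count-mono p⇒q = sum-mono-≤ (𝟙-mono ∘ p⇒q)

count-mono-except : ∀ {n} {p q : Fin n → Bool} k₀ →
  (∀ k → k ≢ k₀ → T (p k) → T (q k)) → count p ≤ suc (count q)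
count-mono-except {p = p} k₀ p⇒q =
  sum-mono-≤-except k₀ (λ k k≢k₀ → 𝟙-mono (p⇒q k k≢k₀)) (≤-trans (𝟙≤1 (p k₀)) (s≤s z≤n))

count-permute : ∀ {n} (p : Fin n → Bool) (π : Perm n) → count (p ∘ (π ⟨$⟩ʳ_)) ≡ count p
count-permute p π = sym (sum-permute (𝟙 ∘ p) π)

count-toℕ<ᵇ : ∀ {n} v → v ≤ n → count (λ (y : Fin n) → toℕ y <ᵇ v) ≡ v
count-toℕ<ᵇ {zero}  zero    z≤n       = refl
count-toℕ<ᵇ {suc n} zero    z≤n       = count-toℕ<ᵇ {n} zero z≤n
count-toℕ<ᵇ {suc n} (suc v) (s≤s v≤n) = cong suc (count-toℕ<ᵇ v v≤n)

length-filter-tabulate : ∀ {n} {A : Set} {P : A → Set} (P? : Decidable P) (f : Fin n → A) →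
  length (filter P? (tabulate f)) ≡ count (λ k → does (P? (f k)))
length-filter-tabulate {zero}  P? f = refl
length-filter-tabulate {suc n} P? f with does (P? (f zero))
... | true  = cong suc (length-filter-tabulate P? (f ∘ suc))
... | false = length-filter-tabulate P? (f ∘ suc)

_≺_ : ∀ {n} → Fin n → Fin n → Bool
x ≺ y = toℕ x <ᵇ toℕ y

n<ᵇn≡false : ∀ n → (n <ᵇ n) ≡ false
n<ᵇn≡false zero    = refl
n<ᵇn≡false (suc n) = n<ᵇn≡false n

punchIn-≺ : ∀ {n} (p : Fin (suc n)) (x y : Fin n) → (punchIn p x ≺ punchIn p y) ≡ (x ≺ y)
punchIn-≺ zero    x       y       = refl
punchIn-≺ (suc p) zero    zero    = refl
punchIn-≺ (suc p) zero    (suc y) = refl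
punchIn-≺ (suc p) (suc x) zero    = refl
punchIn-≺ (suc p) (suc x) (suc y) = punchIn-≺ p x y

isInversion : ∀ {m} → Perm (suc m) → Fin m → Fin (suc m) → Bool
isInversion w i k = (inject₁ i ≺ k) ∧ ((w ⟨$⟩ʳ k) ≺ (w ⟨$⟩ʳ inject₁ i))

code≡count : ∀ {m} (w : Perm (suc m)) i → code w i ≡ count (isInversion w i)
code≡count w i = length-filter-tabulate
  (λ k → (inject₁ i <? k) ×-dec ((w ⟨$⟩ʳ k) <? (w ⟨$⟩ʳ inject₁ i))) id

code-cong : ∀ {m} (w w′ : Perm (suc m)) → w ≈ w′ → ∀ i → code w i ≡ code w′ i
code-cong w w′ w≈w′ i = begin
  code w i                   ≡⟨ code≡count w i ⟩
  count (isInversion w i)    ≡⟨ count-cong same-inversions ⟩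
  count (isInversion w′ i)   ≡⟨ code≡count w′ i ⟨
  code w′ i                  ∎
  where
  open ≡-Reasoning
  same-inversions : ∀ k → isInversion w i k ≡ isInversion w′ i k
  same-inversions k =
    cong₂ (λ a b → (inject₁ i ≺ k) ∧ (a ≺ b)) (w≈w′ k) (w≈w′ (inject₁ i))

code-id : ∀ {m} (i : Fin m) → code (idₚ {suc m}) i ≡ 0
code-id i = trans (code≡count idₚ i) (count-none not-inversion)
  where
  not-inversion : ∀ k → ¬ T (isInversion idₚ i k)
  not-inversion k inv with Equivalence.to (T-∧ {inject₁ i ≺ k}) inv
  ... | i≺k , k≺i = <⇒≱ (<ᵇ⇒< _ _ i≺k) (<⇒≤ (<ᵇ⇒< (toℕ k) (toℕ (inject₁ i)) k≺i))

code-zero : ∀ {m} (w : Perm (suc (suc m))) → code w zero ≡ toℕ (w ⟨$⟩ʳ zero)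
code-zero w = begin
  code w zero                       ≡⟨ code≡count w zero ⟩
  count (isInversion w zero)        ≡⟨ count-cong inversion⇔below ⟩
  count ((_≺ w₀) ∘ (w ⟨$⟩ʳ_))       ≡⟨ count-permute (_≺ w₀) w ⟩
  count (_≺ w₀)                     ≡⟨ count-toℕ<ᵇ (toℕ w₀) (<⇒≤ (toℕ<n w₀)) ⟩
  toℕ w₀                            ∎
  where
  open ≡-Reasoning
  w₀ = w ⟨$⟩ʳ zero
  inversion⇔below : ∀ k → isInversion w zero k ≡ ((w ⟨$⟩ʳ k) ≺ w₀)
  inversion⇔below zero    = sym (n<ᵇn≡false (toℕ w₀))
  inversion⇔below (suc k) = refl

code-suc : ∀ {m} (w : Perm (suc (suc m))) i → code w (suc i) ≡ code (remove zero w) i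
code-suc w i = begin
  code w (suc i)                  ≡⟨ code≡count w (suc i) ⟩
  count (isInversion w (suc i))   ≡⟨ count-cong (λ k → cong ((inject₁ i ≺ k) ∧_) (order-remove k)) ⟩
  count (isInversion ρ i)         ≡⟨ code≡count ρ i ⟨
  code ρ i                        ∎
  where
  open ≡-Reasoning
  ρ = remove zero w
  order-remove : ∀ k →
    ((w ⟨$⟩ʳ suc k) ≺ (w ⟨$⟩ʳ suc (inject₁ i))) ≡ ((ρ ⟨$⟩ʳ k) ≺ (ρ ⟨$⟩ʳ inject₁ i))
  order-remove k =
    trans (cong₂ _≺_ (punchIn-permute w zero k) (punchIn-permute w zero (inject₁ i)))
          (punchIn-≺ (w ⟨$⟩ʳ zero) _ _)

swapℕ : ℕ → ℕ → ℕ
swapℕ zero    zero          = 1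
swapℕ zero    (suc zero)    = 0
swapℕ zero    (suc (suc x)) = suc (suc x)
swapℕ (suc j) zero          = zero
swapℕ (suc j) (suc x)       = suc (swapℕ j x)

toℕ-s : ∀ {m} (j : Fin m) x → toℕ (s j ⟨$⟩ʳ x) ≡ swapℕ (toℕ j) (toℕ x)
toℕ-s zero    zero          = refl
toℕ-s zero    (suc zero)    = refl
toℕ-s zero    (suc (suc x)) = refl
toℕ-s (suc j) zero          = refl
toℕ-s (suc j) (suc x)       =
  trans (cong toℕ (lift₀-transpose (inject₁ j) (suc j) (suc x))) (cong suc (toℕ-s j x))

swapℕ-reflects-< : ∀ j x y → x ≢ y → (y ≡ j → x ≢ suc j) → swapℕ j x < swapℕ j y → x < y
swapℕ-reflects-< zero    zero          zero          x≢y _   _   = ⊥-elim (x≢y refl)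
swapℕ-reflects-< zero    zero          (suc y)       _   _   _   = s≤s z≤n
swapℕ-reflects-< zero    (suc zero)    zero          _   exc _   = ⊥-elim (exc refl refl)
swapℕ-reflects-< zero    (suc zero)    (suc zero)    x≢y _   _   = ⊥-elim (x≢y refl)
swapℕ-reflects-< zero    (suc zero)    (suc (suc y)) _   _   _   = s≤s (s≤s z≤n)
swapℕ-reflects-< zero    (suc (suc x)) zero          _   _   (s≤s ())
swapℕ-reflects-< zero    (suc (suc x)) (suc zero)    _   _   ()
swapℕ-reflects-< zero    (suc (suc x)) (suc (suc y)) _   _   x<y = x<y
swapℕ-reflects-< (suc j) zero          zero          x≢y _   _   = ⊥-elim (x≢y refl)
swapℕ-reflects-< (suc j) zero          (suc y)       _   _   _   = s≤s z≤n
swapℕ-reflects-< (suc j) (suc x)       zero          _   _   ()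
swapℕ-reflects-< (suc j) (suc x)       (suc y)       x≢y exc (s≤s sx<sy) =
  s≤s (swapℕ-reflects-< j x y (x≢y ∘ cong suc) (λ y≡j → exc (cong suc y≡j) ∘ cong suc) sx<sy)

s-reflects-< : ∀ {m} (j : Fin m) {x y : Fin (suc m)} → x ≢ y → (y ≡ inject₁ j → x ≢ suc j) →
  toℕ (s j ⟨$⟩ʳ x) < toℕ (s j ⟨$⟩ʳ y) → toℕ x < toℕ y
s-reflects-< j {x} {y} x≢y exc sx<sy = swapℕ-reflects-< (toℕ j) (toℕ x) (toℕ y)
  (x≢y ∘ toℕ-injective)
  (λ y≡j x≡1+j → exc (toℕ-injective (trans y≡j (sym (toℕ-inject₁ j)))) (toℕ-injective x≡1+j))
  (subst₂ _<_ (toℕ-s j x) (toℕ-s j y) sx<sy)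

isInversion-∘s : ∀ {m} (π : Perm (suc m)) j i k →
  (π ⟨$⟩ʳ inject₁ i ≡ inject₁ j → π ⟨$⟩ʳ k ≢ suc j) →
  T (isInversion (π ∘ₚ s j) i k) → T (isInversion π i k)
isInversion-∘s π j i k exc inv with Equivalence.to (T-∧ {inject₁ i ≺ k}) inv
... | i≺k , sπk≺sπi = Equivalence.from T-∧ (i≺k , <⇒<ᵇ πk<πi)
  where
  πk≢πi : π ⟨$⟩ʳ k ≢ π ⟨$⟩ʳ inject₁ i
  πk≢πi πk≡πi = <-irrefl (cong toℕ (sym (Injection.injective (↔⇒↣ π) πk≡πi))) (<ᵇ⇒< _ _ i≺k)
  πk<πi : toℕ (π ⟨$⟩ʳ k) < toℕ (π ⟨$⟩ʳ inject₁ i)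
  πk<πi = s-reflects-< j πk≢πi exc (<ᵇ⇒< _ _ sπk≺sπi)

code-∘s-≤ : ∀ {m} (π : Perm (suc m)) j i → π ⟨$⟩ʳ inject₁ i ≢ inject₁ j →
  code (π ∘ₚ s j) i ≤ code π i
code-∘s-≤ π j i πi≢j = begin
  code (π ∘ₚ s j) i                 ≡⟨ code≡count (π ∘ₚ s j) i ⟩
  count (isInversion (π ∘ₚ s j) i)  ≤⟨ count-mono (λ k → isInversion-∘s π j i k (⊥-elim ∘ πi≢j)) ⟩
  count (isInversion π i)           ≡⟨ code≡count π i ⟨
  code π i                          ∎
  where open ≤-Reasoning

code-∘s-≤-suc : ∀ {m} (π : Perm (suc m)) j i → code (π ∘ₚ s j) i ≤ suc (code π i)
code-∘s-≤-suc π j i = begin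
  code (π ∘ₚ s j) i                 ≡⟨ code≡count (π ∘ₚ s j) i ⟩
  count (isInversion (π ∘ₚ s j) i)  ≤⟨ count-mono-except (π ⟨$⟩ˡ suc j) inversion-kept ⟩
  suc (count (isInversion π i))     ≡⟨ cong suc (code≡count π i) ⟨
  suc (code π i)                    ∎
  where
  open ≤-Reasoning
  inversion-kept : ∀ k → k ≢ π ⟨$⟩ˡ suc j →
    T (isInversion (π ∘ₚ s j) i k) → T (isInversion π i k)
  inversion-kept k k≢ = isInversion-∘s π j i k
    (λ _ πk≡1+j → k≢ (trans (sym (inverseˡ π)) (cong (π ⟨$⟩ˡ_) πk≡1+j)))

codeSum : ∀ {m} → Perm (suc m) → ℕ
codeSum w = sum (code w)

codeSum-cong : ∀ {m} (w w′ : Perm (suc m)) → w ≈ w′ → codeSum w ≡ codeSum w′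
codeSum-cong {m} w w′ w≈w′ = sum-cong-≗ {m} (code-cong w w′ w≈w′)

codeSum-id : ∀ {m} → codeSum (idₚ {suc m}) ≡ 0
codeSum-id {m} = trans (sum-cong-≗ {m} code-id) (sum-replicate-zero m)

codeSum-∘s : ∀ {m} (π : Perm (suc m)) j → codeSum (π ∘ₚ s j) ≤ suc (codeSum π)
codeSum-∘s π j = sum-mono-≤-but-one (code-∘s-≤-suc π j) λ i i′ i↑ i′↑ →
  inject₁-injective (Injection.injective (↔⇒↣ π)
    (trans (increase⇒at-j i i↑) (sym (increase⇒at-j i′ i′↑))))
  where
  increase⇒at-j : ∀ i → code π i < code (π ∘ₚ s j) i → π ⟨$⟩ʳ inject₁ i ≡ inject₁ j
  increase⇒at-j i up =
    decidable-stable (π ⟨$⟩ʳ inject₁ i ≟ inject₁ j) (<⇒≱ up ∘ code-∘s-≤ π j i)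

codeSum-≤-length : ∀ {m} (vs : List (Fin m)) (w : Perm (suc m)) →
  prod vs ≈ w → codeSum w ≤ length vs
codeSum-≤-length {m} []   w id≈w =
  ≤-reflexive (trans (sym (codeSum-cong idₚ w id≈w)) (codeSum-id {m}))
codeSum-≤-length (j ∷ js) w vs≈w = begin
  codeSum w                   ≡⟨ codeSum-cong (prod js ∘ₚ s j) w vs≈w ⟨
  codeSum (prod js ∘ₚ s j)    ≤⟨ codeSum-∘s (prod js) j ⟩
  suc (codeSum (prod js))     ≤⟨ s≤s (codeSum-≤-length js (prod js) (λ _ → refl)) ⟩
  suc (length js)             ∎
  where open ≤-Reasoning

punchInℕ : ℕ → ℕ → ℕ
punchInℕ zero    y       = suc y
punchInℕ (suc p) zero    = zero
punchInℕ (suc p) (suc y) = suc (punchInℕ p y)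

toℕ-punchIn : ∀ {n} (p : Fin (suc n)) x → toℕ (punchIn p x) ≡ punchInℕ (toℕ p) (toℕ x)
toℕ-punchIn zero    x       = refl
toℕ-punchIn (suc p) zero    = refl
toℕ-punchIn (suc p) (suc x) = cong suc (toℕ-punchIn p x)

cycleℕ : ℕ → ℕ → ℕ
cycleℕ k zero    = k
cycleℕ k (suc y) = punchInℕ k y

cycleℕ-suc : ∀ k x → cycleℕ (suc k) x ≡ swapℕ k (cycleℕ k x)
cycleℕ-suc k zero    = sym (swapℕ-self k)
  where
  swapℕ-self : ∀ k → swapℕ k k ≡ suc k
  swapℕ-self zero    = refl
  swapℕ-self (suc k) = cong suc (swapℕ-self k)
cycleℕ-suc k (suc y) = punchInℕ-suc k y
  where
  punchInℕ-suc : ∀ k y → punchInℕ (suc k) y ≡ swapℕ k (punchInℕ k y)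
  punchInℕ-suc zero    zero    = refl
  punchInℕ-suc zero    (suc y) = refl
  punchInℕ-suc (suc k) zero    = refl
  punchInℕ-suc (suc k) (suc y) = cong suc (punchInℕ-suc k y)

-- Saturates at m; it is only applied to k ≤ m, where toℕ (clamp k) ≡ k.
clamp : ∀ {m} → ℕ → Fin (suc m)
clamp         zero    = zero
clamp {zero}  (suc k) = zero
clamp {suc m} (suc k) = suc (clamp k)

toℕ-clamp : ∀ {m} k → k ≤ m → toℕ (clamp {m} k) ≡ k
toℕ-clamp         zero    _         = refl
toℕ-clamp {suc m} (suc k) (s≤s k≤m) = cong suc (toℕ-clamp k k≤m)

block : ∀ {m} → ℕ → List (Fin (suc m))
block zero    = []
block (suc k) = clamp k ∷ block k

length-block : ∀ {m} k → length (block {m} k) ≡ k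
length-block zero    = refl
length-block (suc k) = cong suc (length-block k)

toℕ-prod-block : ∀ {m} k → k ≤ suc m → ∀ x →
  toℕ (prod (block {m} k) ⟨$⟩ʳ x) ≡ cycleℕ k (toℕ x)
toℕ-prod-block zero    _         zero    = refl
toℕ-prod-block zero    _         (suc x) = refl
toℕ-prod-block (suc k) (s≤s k≤m) x = begin
  toℕ (s (clamp k) ⟨$⟩ʳ (prod (block k) ⟨$⟩ʳ x))       ≡⟨ toℕ-s (clamp k) _ ⟩
  swapℕ (toℕ (clamp k)) (toℕ (prod (block k) ⟨$⟩ʳ x))  ≡⟨ cong₂ swapℕ (toℕ-clamp k k≤m) IH ⟩
  swapℕ k (cycleℕ k (toℕ x))                           ≡⟨ cycleℕ-suc k (toℕ x) ⟨
  cycleℕ (suc k) (toℕ x)                               ∎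
  where
  open ≡-Reasoning
  IH = toℕ-prod-block k (m≤n⇒m≤1+n k≤m) x

prod-++ : ∀ {m} (xs ys : List (Fin m)) x →
  prod (xs ++ ys) ⟨$⟩ʳ x ≡ prod xs ⟨$⟩ʳ (prod ys ⟨$⟩ʳ x)
prod-++ []       ys x = refl
prod-++ (j ∷ xs) ys x = cong (s j ⟨$⟩ʳ_) (prod-++ xs ys x)

prod-map-suc : ∀ {m} (ws : List (Fin m)) → prod (map suc ws) ≈ lift₀ (prod ws)
prod-map-suc []       x = sym (lift₀-id x)
prod-map-suc (j ∷ ws) x = begin
  s (suc j) ⟨$⟩ʳ (prod (map suc ws) ⟨$⟩ʳ x)  ≡⟨ cong (s (suc j) ⟨$⟩ʳ_) (prod-map-suc ws x) ⟩
  s (suc j) ⟨$⟩ʳ (lift₀ (prod ws) ⟨$⟩ʳ x)    ≡⟨ lift₀-transpose (inject₁ j) (suc j) _ ⟩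
  lift₀ (s j) ⟨$⟩ʳ (lift₀ (prod ws) ⟨$⟩ʳ x)  ≡⟨ lift₀-comp (prod ws) (s j) x ⟩
  lift₀ (prod ws ∘ₚ s j) ⟨$⟩ʳ x              ∎
  where open ≡-Reasoning

prod-block-lift₀-remove : ∀ {m} (w : Perm (suc (suc m))) x →
  prod (block (toℕ (w ⟨$⟩ʳ zero))) ⟨$⟩ʳ (lift₀ (remove zero w) ⟨$⟩ʳ x) ≡ w ⟨$⟩ʳ x
prod-block-lift₀-remove w x =
  toℕ-injective (trans (toℕ-prod-block (toℕ w₀) (≤-pred (toℕ<n w₀)) _) (cycle-remove x))
  where
  w₀ = w ⟨$⟩ʳ zero
  cycle-remove : ∀ x → cycleℕ (toℕ w₀) (toℕ (lift₀ (remove zero w) ⟨$⟩ʳ x)) ≡ toℕ (w ⟨$⟩ʳ x)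
  cycle-remove zero    = refl
  cycle-remove (suc y) = sym (trans (cong toℕ (punchIn-permute w zero y)) (toℕ-punchIn w₀ _))

canonicalWord : ∀ {m} → (Fin m → ℕ) → List (Fin m)
canonicalWord {zero}  c = []
canonicalWord {suc m} c = block (c zero) ++ map suc (canonicalWord (c ∘ suc))

length-canonicalWord : ∀ {m} (c : Fin m → ℕ) → length (canonicalWord c) ≡ sum c
length-canonicalWord {zero}  c = refl
length-canonicalWord {suc m} c = begin
  length (block (c zero) ++ map suc rest)              ≡⟨ length-++ (block (c zero)) ⟩
  length (block {m} (c zero)) + length (map suc rest)  ≡⟨ cong₂ _+_ (length-block (c zero)) (length-map suc rest) ⟩
  c zero + length rest                                 ≡⟨ cong (c zero +_) (length-canonicalWord (c ∘ suc)) ⟩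
  c zero + sum (c ∘ suc)                               ∎
  where
  open ≡-Reasoning
  rest = canonicalWord (c ∘ suc)

canonicalWord-cong : ∀ {m} {c d : Fin m → ℕ} → (∀ k → c k ≡ d k) →
  canonicalWord c ≡ canonicalWord d
canonicalWord-cong {zero}  c≡d = refl
canonicalWord-cong {suc m} c≡d =
  cong₂ (λ a ws → block a ++ map suc ws) (c≡d zero) (canonicalWord-cong (c≡d ∘ suc))

canonicalWord-⊆ : ∀ {m} {c c′ : Fin m → ℕ} i →
  suc (c′ i) ≡ c i → (∀ k → k ≢ i → c′ k ≡ c k) → canonicalWord c′ ⊆ canonicalWord c
canonicalWord-⊆ {suc m} {c} {c′} zero c′₀+1≡c₀ c′≡c = Sublist.++⁺
  (subst (λ n → block (c′ zero) ⊆ block n) c′₀+1≡c₀ (clamp (c′ zero) ∷ʳ ⊆-refl))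
  (Sublist.map⁺ suc (⊆-reflexive (canonicalWord-cong (λ k → c′≡c (suc k) λ ()))))
canonicalWord-⊆ {suc m} {c} {c′} (suc i) c′i+1≡ci c′≡c = Sublist.++⁺
  (⊆-reflexive (cong block (c′≡c zero λ ())))
  (Sublist.map⁺ suc (canonicalWord-⊆ i c′i+1≡ci c′≡c-tail))
  where
  c′≡c-tail : ∀ k → k ≢ i → c′ (suc k) ≡ c (suc k)
  c′≡c-tail k k≢i = c′≡c (suc k) (k≢i ∘ suc-injective)

prod-canonicalWord : ∀ {m} (w : Perm (suc m)) → prod (canonicalWord (code w)) ≈ w
prod-canonicalWord {zero}  w zero with w ⟨$⟩ʳ zero
... | zero = refl
prod-canonicalWord {suc m} w x = begin
  prod (canonicalWord (code w)) ⟨$⟩ʳ x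
    ≡⟨ prod-++ (block (code w zero)) _ x ⟩
  prod (block (code w zero)) ⟨$⟩ʳ (prod (map suc (canonicalWord (code w ∘ suc))) ⟨$⟩ʳ x)
    ≡⟨ cong₂ (λ c ws → prod (block c) ⟨$⟩ʳ (prod (map suc ws) ⟨$⟩ʳ x))
             (code-zero w) (canonicalWord-cong (code-suc w)) ⟩
  cycle ⟨$⟩ʳ (prod (map suc (canonicalWord (code ρ))) ⟨$⟩ʳ x)
    ≡⟨ cong (cycle ⟨$⟩ʳ_) (trans (prod-map-suc (canonicalWord (code ρ)) x)
                                  (lift₀-cong _ ρ (prod-canonicalWord ρ) x)) ⟩
  cycle ⟨$⟩ʳ (lift₀ ρ ⟨$⟩ʳ x)
    ≡⟨ prod-block-lift₀-remove w x ⟩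
  w ⟨$⟩ʳ x
    ∎
  where
  open ≡-Reasoning
  ρ = remove zero w
  cycle = prod (block (toℕ (w ⟨$⟩ʳ zero)))

canonicalWord-reduced : ∀ {m} (w : Perm (suc m)) → Reduced (canonicalWord (code w)) w
canonicalWord-reduced w = prod-canonicalWord w , λ vs vs≈w →
  subst (_≤ length vs) (sym (length-canonicalWord (code w))) (codeSum-≤-length vs w vs≈w)

hasLength-codeSum : ∀ {m} (w : Perm (suc m)) → HasLength w (codeSum w)
hasLength-codeSum w =
  canonicalWord (code w) , canonicalWord-reduced w , length-canonicalWord (code w)

lemma2p3 : ∀ (m : ℕ) (w w′ : Perm (suc m)) →
    (∃[ i ] (suc (code w′ i) ≡ code w i × (∀ k → k ≢ i → code w′ k ≡ code w k))) →
    Covers w w′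
lemma2p3 m w w′ (i , c′i+1≡ci , c′≡c) =
  ( canonicalWord (code w) , canonicalWord-reduced w
  , canonicalWord (code w′) , canonicalWord-⊆ i c′i+1≡ci c′≡c , prod-canonicalWord w′ )
  , codeSum w′ , hasLength-codeSum w′
  , subst (HasLength w) (sum-suc-at i c′i+1≡ci c′≡c) (hasLength-codeSum w)
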